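{- Let $F$ be a cyclic cubic field with ring of integers $O_F$ and conductor $p$. Then $\|g\|^2\ge \frac{2p}{3}$ for all $g\in O_F\setminus\mathbb{Z}$.
   Context: $F$ is totally real, fixed in $\mathbb{R}$, with Galois group generated by $\sigma$; for $g\in F$, $\|g\|^2=\sum_{i=0}^2\sigma^i(g)^2$. The discriminant of $F$ is $p^2$. -}

module Defs where

open import Data.Rational using (ℚ; 0ℚ; 1ℚ; _+_; _*_; _-_; _/_; _≤_)
open import Data.Integer using (ℤ)
open import Data.Nat using (ℕ)
open import Data.Fin using (Fin; zero; suc)
open import Data.List using (List; foldl)
open import Data.Product using (Σ; _×_; ∃)
open import Relation.Binary.PropositionalEquality using (_≡_; _≢_)

-- A monic cubic  x³ + a x² + b x + c  over ℚ.
record Cubic : Set where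
  field
    a b c : ℚ

-- An element  e0 + e1 θ + e2 θ²  of ℚ[x]/(x³ + a x² + b x + c),
-- θ being the class of x (coordinates in the ℚ-basis 1, θ, θ²).
record Elt : Set where
  constructor ⟨_,_,_⟩
  field
    e0 e1 e2 : ℚ

open Elt public

ℤ→ℚ : ℤ → ℚ
ℤ→ℚ n = n / 1

module Arith (f : Cubic) where
  open Cubic f

  embed : ℚ → Elt
  embed q = ⟨ q , 0ℚ , 0ℚ ⟩

  embedℤ : ℤ → Elt
  embedℤ n = embed (ℤ→ℚ n)

  0F 1F θ θ² : Elt
  0F = embed 0ℚ
  1F = embed 1ℚ
  θ  = ⟨ 0ℚ , 1ℚ , 0ℚ ⟩
  θ² = ⟨ 0ℚ , 0ℚ , 1ℚ ⟩

  infixl 6 _+F_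
  infixl 7 _*F_

  _+F_ : Elt → Elt → Elt
  ⟨ x0 , x1 , x2 ⟩ +F ⟨ y0 , y1 , y2 ⟩ = ⟨ x0 + y0 , x1 + y1 , x2 + y2 ⟩

  -- polynomial product, then reduction using θ³ = - a θ² - b θ - c
  _*F_ : Elt → Elt → Elt
  ⟨ x0 , x1 , x2 ⟩ *F ⟨ y0 , y1 , y2 ⟩ =
    let d0 = x0 * y0
        d1 = x0 * y1 + x1 * y0
        d2 = x0 * y2 + x1 * y1 + x2 * y0
        d3 = x1 * y2 + x2 * y1
        d4 = x2 * y2
        -- eliminate θ⁴ = - a θ³ - b θ² - c θ
        d3' = d3 - a * d4
        d2' = d2 - b * d4
        d1' = d1 - c * d4
        -- eliminate θ³ = - a θ² - b θ - c
    in ⟨ d0 - c * d3' , d1' - b * d3' , d2' - a * d3' ⟩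

  IsField : Set
  IsField = ∀ x → x ≢ 0F → ∃ λ y → x *F y ≡ 1F

  -- trace Tr_{F/ℚ}: trace of the multiplication-by-x matrix in the basis 1, θ, θ²
  Tr : Elt → ℚ
  Tr x = e0 (x *F 1F) + e1 (x *F θ) + e2 (x *F θ²)

  -- value at g of the monic polynomial  X^n + c_{n-1} X^{n-1} + ... + c_0
  -- where the list is [c_{n-1}, ..., c_0]
  evalMonic : List ℤ → Elt → Elt
  evalMonic cs g = foldl (λ acc k → acc *F g +F embedℤ k) 1F cs

  IsIntegral : Elt → Set
  IsIntegral g = ∃ λ (cs : List ℤ) → evalMonic cs g ≡ 0F

  -- ring automorphism of F (ring endomorphisms of a field fixing 1 fix ℚ)
  IsRingHom : (Elt → Elt) → Set
  IsRingHom σ = (∀ x y → σ (x +F y) ≡ σ x +F σ y)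
              × (∀ x y → σ (x *F y) ≡ σ x *F σ y)
              × (σ 1F ≡ 1F)

  -- σ generates a cyclic Galois group of order 3 (F cyclic cubic)
  IsCyclicGenerator : (Elt → Elt) → Set
  IsCyclicGenerator σ = IsRingHom σ
                      × (∀ x → σ (σ (σ x)) ≡ x)
                      × ∃ (λ x → σ x ≢ x)

  det3 : (Fin 3 → Fin 3 → ℚ) → ℚ
  det3 m =
      m zero zero * (m one one * m two two - m one two * m two one)
    - m zero one * (m one zero * m two two - m one two * m two zero)
    + m zero two * (m one zero * m two one - m one one * m two zero)
    where
      one two : Fin 3
      one = suc zero
      two = suc (suc zero)

  lin : (Fin 3 → ℤ) → (Fin 3 → Elt) → Elt
  lin n ω = embedℤ (n zero) *F ω zero
         +F embedℤ (n (suc zero)) *F ω (suc zero)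
         +F embedℤ (n (suc (suc zero))) *F ω (suc (suc zero))

  IsIntegralBasis : (Fin 3 → Elt) → Set
  IsIntegralBasis ω = (∀ i → IsIntegral (ω i))
                    × (∀ g → IsIntegral g → ∃ λ (n : Fin 3 → ℤ) → g ≡ lin n ω)

  disc : (Fin 3 → Elt) → ℚ
  disc ω = det3 (λ i j → Tr (ω i *F ω j))

  HasDiscriminant : ℚ → Set
  HasDiscriminant D = ∃ λ ω → IsIntegralBasis ω × disc ω ≡ D

  normSq : (Elt → Elt) → Elt → Elt
  normSq σ g = g *F g +F σ g *F σ g +F σ (σ g) *F σ (σ g)

-- Write g₁ = σ g, g₂ = σ² g and t = Tr g, M = Tr g² = ‖g‖², P = Tr (g g₁), so that t² = M + 2P.
-- The Gram matrix of 1, g, g₁ for the trace form is [[3, t, t], [t, M, P], [t, P, M]], with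
-- determinant (M - P)(3M + 3P - 2t²) = (M - P)². As 1, g, g₁ lie in O_F, this determinant is
-- D² · disc(O_F) = D² p² for an integer D, the determinant of their coordinates in an integral basis.
-- For g ∉ ℚ the number 2 (M - P) = Σ (gᵢ - gᵢ₊₁)² is positive, so D ≠ 0 and M - P ≥ p; hence
-- 3M = t² + 2 (M - P) ≥ 2p.

module Submission where

open import Defs
open import Data.Nat as ℕ using (ℕ; zero; suc)
open import Data.Integer as ℤ using (ℤ)
import Data.Integer.Properties as ℤ
import Data.Nat.Coprimality as Coprime
open import Data.Rational as ℚ using (ℚ; 0ℚ; 1ℚ; mkℚ; ↥_; ↧_)
import Data.Rational.Properties as ℚ
open import Data.Fin using (Fin; zero; suc; #_; combine; _↑ˡ_; _↑ʳ_)
open import Data.Vec using (Vec; []; _∷_; _++_; concat; tabulate; lookup)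
open import Data.Vec.Properties using (tabulate-cong)
open import Data.List using (List; []; _∷_; foldl)
open import Data.Product using (_×_; ∃; _,_; proj₁; proj₂)
import Data.Maybe as Maybe
open import Level using (0ℓ)
open import Relation.Binary.PropositionalEquality
open import Relation.Nullary.Decidable using (dec⇒maybe)
open import Algebra.Bundles using (CommutativeRing)
open import Algebra.Structures using (IsCommutativeRing)
import Algebra.Solver.Ring
import Algebra.Solver.Ring.AlmostCommutativeRing as ACR
import Tactic.RingSolver.Core.AlmostCommutativeRing as TACR
open import Tactic.RingSolver using (solve-∀)

cong₃ : ∀ {A B C D : Set} (h : A → B → C → D) {x x′ y y′ z z′} →
        x ≡ x′ → y ≡ y′ → z ≡ z′ → h x y z ≡ h x′ y′ z′
cong₃ h refl refl refl = refl

private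
  0≟_ : (x : ℚ) → Maybe.Maybe (0ℚ ≡ x)
  0≟ x = dec⇒maybe (0ℚ ℚ.≟ x)

ℚ-almostCommutativeRing : TACR.AlmostCommutativeRing 0ℓ 0ℓ
ℚ-almostCommutativeRing = TACR.fromCommutativeRing ℚ.+-*-commutativeRing 0≟_

ℤ→ℚ≡mkℚ : ∀ n → ℤ→ℚ n ≡ mkℚ n 0 (Coprime.sym (Coprime.1-coprimeTo ℤ.∣ n ∣))
ℤ→ℚ≡mkℚ n = ℚ.↥p/↧p≡p (mkℚ n 0 (Coprime.sym (Coprime.1-coprimeTo ℤ.∣ n ∣)))

ℤ→ℚ-+ : ∀ m n → ℤ→ℚ (m ℤ.+ n) ≡ ℤ→ℚ m ℚ.+ ℤ→ℚ n
ℤ→ℚ-+ m n = trans (cong₂ (λ i j → (i ℤ.+ j) ℚ./ 1) (sym (ℤ.*-identityʳ m)) (sym (ℤ.*-identityʳ n)))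
                  (sym (cong₂ ℚ._+_ (ℤ→ℚ≡mkℚ m) (ℤ→ℚ≡mkℚ n)))

ℤ→ℚ-* : ∀ m n → ℤ→ℚ (m ℤ.* n) ≡ ℤ→ℚ m ℚ.* ℤ→ℚ n
ℤ→ℚ-* m n = sym (cong₂ ℚ._*_ (ℤ→ℚ≡mkℚ m) (ℤ→ℚ≡mkℚ n))

ℤ→ℚ-neg : ∀ n → ℤ→ℚ (ℤ.- n) ≡ ℚ.- ℤ→ℚ n
ℤ→ℚ-neg n = trans (ℤ→ℚ≡mkℚ (ℤ.- n)) (trans (neg-mkℚ n) (cong ℚ.-_ (sym (ℤ→ℚ≡mkℚ n))))
  where
  neg-mkℚ : ∀ n → mkℚ (ℤ.- n) 0 (Coprime.sym (Coprime.1-coprimeTo ℤ.∣ ℤ.- n ∣))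
                ≡ ℚ.- mkℚ n 0 (Coprime.sym (Coprime.1-coprimeTo ℤ.∣ n ∣))
  neg-mkℚ ℤ.-[1+ n ]    = refl
  neg-mkℚ (ℤ.+ zero)    = refl
  neg-mkℚ (ℤ.+ suc n)   = refl

↥-ℤ→ℚ : ∀ n → ↥ ℤ→ℚ n ≡ n
↥-ℤ→ℚ n = cong ↥_ (ℤ→ℚ≡mkℚ n)

ℤ→ℚ-injective : ∀ {m n} → ℤ→ℚ m ≡ ℤ→ℚ n → m ≡ n
ℤ→ℚ-injective {m} {n} eq = trans (sym (↥-ℤ→ℚ m)) (trans (cong ↥_ eq) (↥-ℤ→ℚ n))

module RationalRootTheorem where

  open import Data.Integer using (+_)
  open import Data.Rational using (_+_; _*_)
  import Data.Nat.Properties as ℕ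
  import Data.Nat.Divisibility as ℕ
  import Data.Rational.Unnormalised as ℚᵘ
  import Data.Rational.Unnormalised.Properties as ℚᵘ
  import Data.Integer.Tactic.RingSolver as ℤ-Solver
  open import Algebra.Properties.AbelianGroup ℤ.+-0-abelianGroup using (inverseˡ-unique)
  open ≡-Reasoning

  q*↧q≡↥q : ∀ q → q * ℤ→ℚ (↧ q) ≡ ℤ→ℚ (↥ q)
  q*↧q≡↥q q@(mkℚ n d _) rewrite ℤ→ℚ≡mkℚ (↧ q) | ℤ→ℚ≡mkℚ (↥ q) =
    ℚ.toℚᵘ-injective (ℚᵘ.≃-trans (ℚ.toℚᵘ-homo-* q (mkℚ (↧ q) 0 (Coprime.sym (Coprime.1-coprimeTo ℤ.∣ ↧ q ∣))))
                                 (ℚᵘ.*≡* eq))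
    where
    eq : (n ℤ.* + suc d) ℤ.* + 1 ≡ n ℤ.* (+ (suc d ℕ.* 1))
    eq = trans (ℤ.*-identityʳ _) (cong (λ k → n ℤ.* (+ k)) (sym (ℕ.*-identityʳ (suc d))))

  horner : List ℤ → ℚ → ℚ
  horner cs r = foldl (λ acc k → acc * r + ℤ→ℚ k) 1ℚ cs

  module _ (r : ℚ) where

    private
      n d : ℤ
      n = ↥ r
      d = ↧ r

      step : ℚ → ℤ → ℚ
      step acc k = acc * r + ℤ→ℚ k

    -- After j Horner steps, d ^ j times the accumulator is an integer B ≡ n ^ j (mod d).
    horner-invariant : ∀ cs acc j (B m : ℤ) → acc * ℤ→ℚ (d ℤ.^ j) ≡ ℤ→ℚ B → B ≡ n ℤ.^ j ℤ.+ m ℤ.* d →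
                       foldl step acc cs ≡ 0ℚ → ∃ λ j → ∃ λ m → n ℤ.^ j ℤ.+ m ℤ.* d ≡ + 0
    horner-invariant [] acc j B m scaled B≡ root =
      j , m , trans (sym B≡) (ℤ→ℚ-injective (trans (sym scaled)
                (trans (cong (_* ℤ→ℚ (d ℤ.^ j)) root) (ℚ.*-zeroˡ (ℤ→ℚ (d ℤ.^ j))))))
    horner-invariant (k ∷ cs) acc j B m scaled B≡ =
      horner-invariant cs (step acc k) (suc j) (B ℤ.* n ℤ.+ k ℤ.* (d ℤ.* d ℤ.^ j)) (m ℤ.* n ℤ.+ k ℤ.* d ℤ.^ j)
        scaled′ (trans (cong (λ B → B ℤ.* n ℤ.+ k ℤ.* (d ℤ.* d ℤ.^ j)) B≡) (shift (n ℤ.^ j) m d n k (d ℤ.^ j)))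
      where
      shift : ∀ nʲ m d n k dʲ → (nʲ ℤ.+ m ℤ.* d) ℤ.* n ℤ.+ k ℤ.* (d ℤ.* dʲ)
                              ≡ n ℤ.* nʲ ℤ.+ (m ℤ.* n ℤ.+ k ℤ.* dʲ) ℤ.* d
      shift = ℤ-Solver.solve-∀
      regroup : ∀ acc r k d dʲ → (acc * r + k) * (d * dʲ) ≡ (acc * dʲ) * (r * d) + k * (d * dʲ)
      regroup = solve-∀ ℚ-almostCommutativeRing
      scaled′ : step acc k * ℤ→ℚ (d ℤ.* d ℤ.^ j) ≡ ℤ→ℚ (B ℤ.* n ℤ.+ k ℤ.* (d ℤ.* d ℤ.^ j))
      scaled′ = begin
        (acc * r + ℤ→ℚ k) * ℤ→ℚ (d ℤ.* d ℤ.^ j)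
          ≡⟨ cong ((acc * r + ℤ→ℚ k) *_) (ℤ→ℚ-* d (d ℤ.^ j)) ⟩
        (acc * r + ℤ→ℚ k) * (ℤ→ℚ d * ℤ→ℚ (d ℤ.^ j))
          ≡⟨ regroup acc r (ℤ→ℚ k) (ℤ→ℚ d) (ℤ→ℚ (d ℤ.^ j)) ⟩
        (acc * ℤ→ℚ (d ℤ.^ j)) * (r * ℤ→ℚ d) + ℤ→ℚ k * (ℤ→ℚ d * ℤ→ℚ (d ℤ.^ j))
          ≡⟨ cong₂ (λ u v → u * v + ℤ→ℚ k * (ℤ→ℚ d * ℤ→ℚ (d ℤ.^ j))) scaled (q*↧q≡↥q r) ⟩
        ℤ→ℚ B * ℤ→ℚ n + ℤ→ℚ k * (ℤ→ℚ d * ℤ→ℚ (d ℤ.^ j))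
          ≡⟨ cong₂ _+_ (ℤ→ℚ-* B n) (cong (ℤ→ℚ k *_) (ℤ→ℚ-* d (d ℤ.^ j))) ⟨
        ℤ→ℚ (B ℤ.* n) + ℤ→ℚ k * ℤ→ℚ (d ℤ.* d ℤ.^ j)
          ≡⟨ cong (λ y → ℤ→ℚ (B ℤ.* n) + y) (ℤ→ℚ-* k (d ℤ.* d ℤ.^ j)) ⟨
        ℤ→ℚ (B ℤ.* n) + ℤ→ℚ (k ℤ.* (d ℤ.* d ℤ.^ j))
          ≡⟨ ℤ→ℚ-+ (B ℤ.* n) (k ℤ.* (d ℤ.* d ℤ.^ j)) ⟨
        ℤ→ℚ (B ℤ.* n ℤ.+ k ℤ.* (d ℤ.* d ℤ.^ j)) ∎

  coprime⇒∣ʲ⇒∣1 : ∀ {m k} → Coprime.Coprime m k → ∀ j → k ℕ.∣ m ℕ.^ j → k ℕ.∣ 1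
  coprime⇒∣ʲ⇒∣1 m⊥k zero    k∣1      = k∣1
  coprime⇒∣ʲ⇒∣1 m⊥k (suc j) k∣m*mʲ = coprime⇒∣ʲ⇒∣1 m⊥k j (Coprime.coprime-divisor (Coprime.sym m⊥k) k∣m*mʲ)

  ∣i^j∣≡∣i∣^j : ∀ (x : ℤ) j → ℤ.∣ x ℤ.^ j ∣ ≡ ℤ.∣ x ∣ ℕ.^ j
  ∣i^j∣≡∣i∣^j x zero    = refl
  ∣i^j∣≡∣i∣^j x (suc j) = trans (ℤ.abs-* x (x ℤ.^ j)) (cong (ℤ.∣ x ∣ ℕ.*_) (∣i^j∣≡∣i∣^j x j))

  rational-root-theorem : ∀ cs r → horner cs r ≡ 0ℚ → ∃ λ k → r ≡ ℤ→ℚ k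
  rational-root-theorem cs r@(mkℚ n d-1 n⊥d) root
    with horner-invariant r cs 1ℚ 0 (+ 1) (+ 0) refl refl root
  ... | j , m , nʲ+md≡0 = n , trans (sym (ℚ.*-identityʳ r)) (trans (cong (r *_) 1≡d) (q*↧q≡↥q r))
    where
    d∣nʲ : suc d-1 ℕ.∣ ℤ.∣ n ∣ ℕ.^ j
    d∣nʲ = ℕ.divides ℤ.∣ m ∣ (begin
      ℤ.∣ n ∣ ℕ.^ j                     ≡⟨ ∣i^j∣≡∣i∣^j n j ⟨
      ℤ.∣ n ℤ.^ j ∣                     ≡⟨ cong ℤ.∣_∣ (inverseˡ-unique (n ℤ.^ j) _ nʲ+md≡0) ⟩
      ℤ.∣ ℤ.- (m ℤ.* + suc d-1) ∣       ≡⟨ ℤ.∣-i∣≡∣i∣ (m ℤ.* + suc d-1) ⟩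
      ℤ.∣ m ℤ.* + suc d-1 ∣             ≡⟨ ℤ.abs-* m (+ suc d-1) ⟩
      ℤ.∣ m ∣ ℕ.* suc d-1 ∎)
    1≡d : 1ℚ ≡ ℤ→ℚ (+ suc d-1)
    1≡d = cong (λ k → ℤ→ℚ (+ k)) (sym (ℕ.∣1⇒≡1 (coprime⇒∣ʲ⇒∣1 (Coprime.recompute n⊥d) j d∣nʲ)))

open RationalRootTheorem

module RationalOrder where

  open import Data.Nat using (z≤n; s≤s)
  import Data.Nat.Properties as ℕ
  open import Data.Integer using (+_; -[1+_])
  open import Data.Rational using (_+_; _*_; _-_; _≤_; _<_; _/_; *≤*)
  open import Data.Sum using (inj₁; inj₂)
  open import Data.Empty using (⊥-elim)
  open import Relation.Binary.Definitions using (tri<; tri≈; tri>)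

  ℤ→ℚ-mono-≤ : ∀ {m n} → m ℤ.≤ n → ℤ→ℚ m ≤ ℤ→ℚ n
  ℤ→ℚ-mono-≤ {m} {n} m≤n rewrite ℤ→ℚ≡mkℚ m | ℤ→ℚ≡mkℚ n =
    *≤* (subst₂ ℤ._≤_ (sym (ℤ.*-identityʳ m)) (sym (ℤ.*-identityʳ n)) m≤n)

  IsInteger : ℚ → Set
  IsInteger q = ∃ λ k → q ≡ ℤ→ℚ k

  integer-+ : ∀ {p q} → IsInteger p → IsInteger q → IsInteger (p + q)
  integer-+ (m , refl) (n , refl) = m ℤ.+ n , sym (ℤ→ℚ-+ m n)

  integer-* : ∀ {p q} → IsInteger p → IsInteger q → IsInteger (p * q)
  integer-* (m , refl) (n , refl) = m ℤ.* n , sym (ℤ→ℚ-* m n)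

  integer-- : ∀ {p q} → IsInteger p → IsInteger q → IsInteger (p - q)
  integer-- (m , refl) (n , refl) = m ℤ.- n , sym (trans (ℤ→ℚ-+ m (ℤ.- n)) (cong (λ y → ℤ→ℚ m + y) (ℤ→ℚ-neg n)))

  0≤x*x : ∀ x → 0ℚ ≤ x * x
  0≤x*x x with ℚ.≤-total 0ℚ x
  ... | inj₁ 0≤x = ℚ.nonNegative⁻¹ (x * x) {{ℚ.nonNeg*nonNeg⇒nonNeg x {{ℚ.nonNegative 0≤x}} x {{ℚ.nonNegative 0≤x}}}}
  ... | inj₂ x≤0 = ℚ.nonNegative⁻¹ (x * x) {{ℚ.nonPos*nonPos⇒nonPos x {{ℚ.nonPositive x≤0}} x {{ℚ.nonPositive x≤0}}}}

  x≢0⇒0<x*x : ∀ x → x ≢ 0ℚ → 0ℚ < x * x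
  x≢0⇒0<x*x x x≢0 with ℚ.<-cmp x 0ℚ
  ... | tri< x<0 _ _ = ℚ.positive⁻¹ (x * x) {{ℚ.neg*neg⇒pos x {{ℚ.negative x<0}} x {{ℚ.negative x<0}}}}
  ... | tri≈ _ x≡0 _ = ⊥-elim (x≢0 x≡0)
  ... | tri> _ _ 0<x = ℚ.positive⁻¹ (x * x) {{ℚ.pos*pos⇒pos x {{ℚ.positive 0<x}} x {{ℚ.positive 0<x}}}}

  0<x*x*x⇒0<x : ∀ x → 0ℚ < x * x * x → 0ℚ < x
  0<x*x*x⇒0<x x 0<x³ = ℚ.≰⇒> λ x≤0 → ℚ.<-irrefl refl (ℚ.<-≤-trans 0<x³ (x³≤0 x≤0))
    where
    x³≤0 : x ≤ 0ℚ → x * x * x ≤ 0ℚ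
    x³≤0 x≤0 = ℚ.nonPositive⁻¹ (x * x * x)
      {{ℚ.nonNeg*nonPos⇒nonPos (x * x) {{ℚ.nonNegative (0≤x*x x)}} x {{ℚ.nonPositive x≤0}}}}

  0<x+x⇒0<x : ∀ {x} → 0ℚ < x + x → 0ℚ < x
  0<x+x⇒0<x {x} 0<2x = ℚ.≰⇒> λ x≤0 → ℚ.<-irrefl refl (ℚ.<-≤-trans 0<2x (ℚ.+-mono-≤ {x} {0ℚ} {x} {0ℚ} x≤0 x≤0))

  0<x*x+x*x+54*y*y : ∀ x {y} → y ≢ 0ℚ → 0ℚ < x * x + x * x + ℤ→ℚ (+ 54) * (y * y)
  0<x*x+x*x+54*y*y x {y} y≢0 = ℚ.+-mono-≤-< (ℚ.+-mono-≤ (0≤x*x x) (0≤x*x x))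
    (ℚ.positive⁻¹ _ {{ℚ.pos*pos⇒pos (ℤ→ℚ (+ 54)) (y * y) {{ℚ.positive (x≢0⇒0<x*x y y≢0)}}}})

  1≤n*n : ∀ {n} → IsInteger n → n ≢ 0ℚ → 1ℚ ≤ n * n
  1≤n*n (k , refl) k≢0 = subst (1ℚ ≤_) (ℤ→ℚ-* k k) (ℤ→ℚ-mono-≤ (1≤k*k k λ k≡0 → k≢0 (cong ℤ→ℚ k≡0)))
    where
    1≤k*k : ∀ k → k ≢ + 0 → + 1 ℤ.≤ k ℤ.* k
    1≤k*k (+ zero)  k≢0 = ⊥-elim (k≢0 refl)
    1≤k*k (+ suc _) _   = ℤ.+≤+ (s≤s z≤n)
    1≤k*k -[1+ _ ]  _   = ℤ.+≤+ (s≤s z≤n)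

  *-self-cancel-≤ : ∀ {x y} → 0ℚ ≤ y → x * x ≤ y * y → x ≤ y
  *-self-cancel-≤ {x} {y} 0≤y x²≤y² = ℚ.≮⇒≥ λ y<x →
    let instance
          x-pos : ℚ.Positive x
          x-pos = ℚ.positive (ℚ.≤-<-trans 0≤y y<x)
          y-nonNeg : ℚ.NonNegative y
          y-nonNeg = ℚ.nonNegative 0≤y
    in ℚ.<-irrefl refl (ℚ.≤-<-trans x²≤y²
         (ℚ.≤-<-trans (ℚ.*-monoˡ-≤-nonNeg y (ℚ.<⇒≤ y<x)) (ℚ.*-monoˡ-<-pos x y<x)))

  ⅓ : ℚ
  ⅓ = + 1 / 3

  n/3≡n*⅓ : ∀ n → + n / 3 ≡ ℤ→ℚ (+ n) * ⅓
  n/3≡n*⅓ n = trans (cong (_/ 3) (sym (ℤ.*-identityʳ (+ n)))) (sym (cong (_* ⅓) (ℤ→ℚ≡mkℚ (+ n))))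

  norm-bound : ∀ p {t M P D} → t * t ≡ M + (P + P) → 0ℚ < M - P → IsInteger D →
               (M - P) * (M - P) ≡ D * D * ℤ→ℚ (+ (p ℕ.^ 2)) → + (2 ℕ.* p) / 3 ≤ M
  norm-bound p {t} {M} {P} {D} t²≡M+2P 0<M-P D-integer gram = begin
    + (2 ℕ.* p) / 3             ≡⟨ trans (n/3≡n*⅓ (2 ℕ.* p)) (cong (_* ⅓) 2p≡p+p) ⟩
    (p̂ + p̂) * ⅓                 ≤⟨ ℚ.*-monoʳ-≤-nonNeg ⅓ (ℚ.≤-trans (ℚ.+-mono-≤ p≤M-P p≤M-P) 2X≤3M) ⟩
    (M + M + M) * ⅓             ≡⟨ thirds M ⅓ ⟩
    M * (ℤ→ℚ (+ 3) * ⅓)         ≡⟨ ℚ.*-identityʳ M ⟩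
    M                           ∎
    where
    open ℚ.≤-Reasoning
    X p̂ : ℚ
    X = M - P
    p̂ = ℤ→ℚ (+ p)
    2p≡p+p : ℤ→ℚ (+ (2 ℕ.* p)) ≡ p̂ + p̂
    2p≡p+p = trans (cong (λ k → ℤ→ℚ (+ (p ℕ.+ k))) (ℕ.+-identityʳ p))
                   (trans (cong ℤ→ℚ (ℤ.pos-+ p p)) (ℤ→ℚ-+ (+ p) (+ p)))
    p²≡p̂*p̂ : ℤ→ℚ (+ (p ℕ.^ 2)) ≡ p̂ * p̂
    p²≡p̂*p̂ = trans (cong (λ k → ℤ→ℚ (+ (p ℕ.* k))) (ℕ.*-identityʳ p))
                   (trans (cong ℤ→ℚ (ℤ.pos-* p p)) (ℤ→ℚ-* (+ p) (+ p)))
    D≢0 : D ≢ 0ℚ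
    D≢0 refl = ℚ.<-irrefl (sym (trans gram (ℚ.*-zeroˡ (ℤ→ℚ (+ (p ℕ.^ 2))))))
                          (x≢0⇒0<x*x X λ X≡0 → ℚ.<-irrefl (sym X≡0) 0<M-P)
    p≤M-P : p̂ ≤ X
    p≤M-P = *-self-cancel-≤ (ℚ.<⇒≤ 0<M-P) (begin
      p̂ * p̂            ≡⟨ ℚ.*-identityˡ (p̂ * p̂) ⟨
      1ℚ * (p̂ * p̂)     ≤⟨ ℚ.*-monoʳ-≤-nonNeg (p̂ * p̂) {{ℚ.nonNegative (0≤x*x p̂)}} (1≤n*n D-integer D≢0) ⟩
      D * D * (p̂ * p̂)  ≡⟨ trans gram (cong (D * D *_) p²≡p̂*p̂) ⟨
      X * X            ∎)
    split : ∀ M P → M + M + M ≡ (M + (P + P)) + ((M - P) + (M - P))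
    split = solve-∀ ℚ-almostCommutativeRing
    thirds : ∀ M ⅓ → (M + M + M) * ⅓ ≡ M * (ℤ→ℚ (+ 3) * ⅓)
    thirds = solve-∀ ℚ-almostCommutativeRing
    2X≤3M : X + X ≤ M + M + M
    2X≤3M = begin
      X + X              ≡⟨ ℚ.+-identityˡ (X + X) ⟨
      0ℚ + (X + X)       ≤⟨ ℚ.+-monoˡ-≤ (X + X) (0≤x*x t) ⟩
      t * t + (X + X)    ≡⟨ trans (cong (_+ (X + X)) t²≡M+2P) (sym (split M P)) ⟩
      M + M + M          ∎

open RationalOrder

open import Tactic.RingSolver.NonReflective ℚ-almostCommutativeRing
  using (module Ops; Expr; Κ; Ι; _⊕_; _⊗_; ⊝_)

-- The arithmetic of Elt is polynomial in the coordinates and in a, b, c, so each identity between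
-- elements is a triple of polynomial identities over ℚ. Sym n is an element with symbolic
-- coordinates, _⊠_ mirrors _*F_ of Defs, and symbolic-≡ lets the ring solver check each coordinate.
record Sym (n : ℕ) : Set where
  constructor ⟪_,_,_⟫
  field s0 s1 s2 : Expr ℚ n

open Sym

⟦_⟧ˢ : ∀ {n} → Sym n → Vec ℚ n → Elt
⟦ X ⟧ˢ ρ = ⟨ Ops.⟦ s0 X ⟧ ρ , Ops.⟦ s1 X ⟧ ρ , Ops.⟦ s2 X ⟧ ρ ⟩

symbolic-≡ : ∀ {n} (L R : Sym n) (ρ : Vec ℚ n) →
             Ops.⟦ s0 L ⇓⟧ ρ ≡ Ops.⟦ s0 R ⇓⟧ ρ → Ops.⟦ s1 L ⇓⟧ ρ ≡ Ops.⟦ s1 R ⇓⟧ ρ →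
             Ops.⟦ s2 L ⇓⟧ ρ ≡ Ops.⟦ s2 R ⇓⟧ ρ → ⟦ L ⟧ˢ ρ ≡ ⟦ R ⟧ˢ ρ
symbolic-≡ L R ρ p0 p1 p2 = cong₃ ⟨_,_,_⟩
  (Ops.prove ρ (s0 L) (s0 R) p0) (Ops.prove ρ (s1 L) (s1 R) p1) (Ops.prove ρ (s2 L) (s2 R) p2)

module Symbolic where
  infixl 6 _⊖_ _⊞_
  infixl 7 _⊠_

  -- Variables 0, 1, 2 stand for a, b, c and variables 3 to 11 for the coordinates of three elements.
  A B C : Expr ℚ 12
  A = Ι (# 0)
  B = Ι (# 1)
  C = Ι (# 2)

  X Y Z Xℚ Yℚ one θˢ θ²ˢ : Sym 12
  X = ⟪ Ι (# 3) , Ι (# 4) , Ι (# 5) ⟫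
  Y = ⟪ Ι (# 6) , Ι (# 7) , Ι (# 8) ⟫
  Z = ⟪ Ι (# 9) , Ι (# 10) , Ι (# 11) ⟫
  Xℚ = ⟪ Ι (# 3) , Κ 0ℚ , Κ 0ℚ ⟫
  Yℚ = ⟪ Ι (# 6) , Κ 0ℚ , Κ 0ℚ ⟫
  one = ⟪ Κ 1ℚ , Κ 0ℚ , Κ 0ℚ ⟫
  θˢ = ⟪ Κ 0ℚ , Κ 1ℚ , Κ 0ℚ ⟫
  θ²ˢ = ⟪ Κ 0ℚ , Κ 0ℚ , Κ 1ℚ ⟫

  _⊖_ : Expr ℚ 12 → Expr ℚ 12 → Expr ℚ 12
  x ⊖ y = x ⊕ ⊝ y

  _⊞_ : Sym 12 → Sym 12 → Sym 12
  ⟪ x0 , x1 , x2 ⟫ ⊞ ⟪ y0 , y1 , y2 ⟫ = ⟪ x0 ⊕ y0 , x1 ⊕ y1 , x2 ⊕ y2 ⟫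

  _⊠_ : Sym 12 → Sym 12 → Sym 12
  ⟪ x0 , x1 , x2 ⟫ ⊠ ⟪ y0 , y1 , y2 ⟫ =
    let d0 = x0 ⊗ y0
        d1 = x0 ⊗ y1 ⊕ x1 ⊗ y0
        d2 = x0 ⊗ y2 ⊕ x1 ⊗ y1 ⊕ x2 ⊗ y0
        d3 = x1 ⊗ y2 ⊕ x2 ⊗ y1
        d4 = x2 ⊗ y2
        d3′ = d3 ⊖ A ⊗ d4
        d2′ = d2 ⊖ B ⊗ d4
        d1′ = d1 ⊖ C ⊗ d4
    in ⟪ d0 ⊖ C ⊗ d3′ , d1′ ⊖ B ⊗ d3′ , d2′ ⊖ A ⊗ d3′ ⟫

  Trˢ : Sym 12 → Expr ℚ 12
  Trˢ x = s0 (x ⊠ one) ⊕ s1 (x ⊠ θˢ) ⊕ s2 (x ⊠ θ²ˢ)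

module CubicField (f : Cubic) where

  open Cubic f
  open Arith f
  open Symbolic

  -F_ : Elt → Elt
  -F x = ⟨ ℚ.- e0 x , ℚ.- e1 x , ℚ.- e2 x ⟩

  -- Opaque copies of the operations of Elt: the ring solver for F below then never unfolds the
  -- rational arithmetic of the coordinates, which would make its proofs impractically slow.
  opaque
    infixl 6 _+_
    infixl 7 _*_
    infix  8 -_

    _+_ _*_ : Elt → Elt → Elt
    _+_ = _+F_
    _*_ = _*F_

    -_ : Elt → Elt
    -_ = -F_

  private
    env : Elt → Elt → Elt → Vec ℚ 12
    env x y z = a ∷ b ∷ c ∷ e0 x ∷ e1 x ∷ e2 x ∷ e0 y ∷ e1 y ∷ e2 y ∷ e0 z ∷ e1 z ∷ e2 z ∷ []

  opaque
    unfolding _+_ _*_ -_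

    +≡+F : ∀ x y → x + y ≡ x +F y
    +≡+F x y = refl

    *≡*F : ∀ x y → x * y ≡ x *F y
    *≡*F x y = refl

    private
      *-comm : ∀ x y → x * y ≡ y * x
      *-comm x y = symbolic-≡ (X ⊠ Y) (Y ⊠ X) (env x y 0F) refl refl refl

      *-assoc : ∀ x y z → (x * y) * z ≡ x * (y * z)
      *-assoc x y z = symbolic-≡ ((X ⊠ Y) ⊠ Z) (X ⊠ (Y ⊠ Z)) (env x y z) refl refl refl

      *-distribˡ : ∀ x y z → x * (y + z) ≡ x * y + x * z
      *-distribˡ x y z = symbolic-≡ (X ⊠ (Y ⊞ Z)) (X ⊠ Y ⊞ X ⊠ Z) (env x y z) refl refl refl

      *-identityˡ : ∀ x → 1F * x ≡ x
      *-identityˡ x = symbolic-≡ (one ⊠ X) X (env x 0F 0F) refl refl refl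

    isCommutativeRing : IsCommutativeRing _≡_ _+_ _*_ -_ 0F 1F
    isCommutativeRing = record
      { isRing = record
        { +-isAbelianGroup = record
          { isGroup = record
            { isMonoid = record
              { isSemigroup = record
                { isMagma = record { isEquivalence = isEquivalence ; ∙-cong = cong₂ _+F_ }
                ; assoc = λ x y z → cong₃ ⟨_,_,_⟩ (ℚ.+-assoc (e0 x) _ _) (ℚ.+-assoc (e1 x) _ _) (ℚ.+-assoc (e2 x) _ _)
                }
              ; identity = (λ x → cong₃ ⟨_,_,_⟩ (ℚ.+-identityˡ (e0 x)) (ℚ.+-identityˡ (e1 x)) (ℚ.+-identityˡ (e2 x)))
                         , (λ x → cong₃ ⟨_,_,_⟩ (ℚ.+-identityʳ (e0 x)) (ℚ.+-identityʳ (e1 x)) (ℚ.+-identityʳ (e2 x)))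
              }
            ; inverse = (λ x → cong₃ ⟨_,_,_⟩ (ℚ.+-inverseˡ (e0 x)) (ℚ.+-inverseˡ (e1 x)) (ℚ.+-inverseˡ (e2 x)))
                      , (λ x → cong₃ ⟨_,_,_⟩ (ℚ.+-inverseʳ (e0 x)) (ℚ.+-inverseʳ (e1 x)) (ℚ.+-inverseʳ (e2 x)))
            ; ⁻¹-cong = cong -F_
            }
          ; comm = λ x y → cong₃ ⟨_,_,_⟩ (ℚ.+-comm (e0 x) _) (ℚ.+-comm (e1 x) _) (ℚ.+-comm (e2 x) _)
          }
        ; *-cong = cong₂ _*F_
        ; *-assoc = *-assoc
        ; *-identity = *-identityˡ , λ x → trans (*-comm x 1F) (*-identityˡ x)
        ; distrib = *-distribˡ
                  , λ x y z → trans (*-comm (y + z) x) (trans (*-distribˡ x y z) (cong₂ _+_ (*-comm x y) (*-comm x z)))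
        }
      ; *-comm = *-comm
      }

    embed-+ : ∀ q r → embed (q ℚ.+ r) ≡ embed q + embed r
    embed-+ q r = refl

    embed-* : ∀ q r → embed (q ℚ.* r) ≡ embed q * embed r
    embed-* q r = symbolic-≡ ⟪ Ι (# 3) ⊗ Ι (# 6) , Κ 0ℚ , Κ 0ℚ ⟫ (Xℚ ⊠ Yℚ) (env (embed q) (embed r) 0F) refl refl refl

    embed-neg : ∀ q → embed (ℚ.- q) ≡ - embed q
    embed-neg q = refl

    embed-- : ∀ q r → embed (q ℚ.- r) ≡ embed q + - embed r
    embed-- q r = refl

    θ-basis : ∀ x → embed (e0 x) + embed (e1 x) * θ + embed (e2 x) * (θ * θ) ≡ x
    θ-basis x = symbolic-≡ (Xℚ ⊞ ⟪ Ι (# 4) , Κ 0ℚ , Κ 0ℚ ⟫ ⊠ θˢ ⊞ ⟪ Ι (# 5) , Κ 0ℚ , Κ 0ℚ ⟫ ⊠ (θˢ ⊠ θˢ)) X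
                          (env x 0F 0F) refl refl refl

    θ-root : θ * θ * θ + embed a * (θ * θ) + embed b * θ + embed c ≡ 0F
    θ-root = symbolic-≡ (θˢ ⊠ θˢ ⊠ θˢ ⊞ ⟪ A , Κ 0ℚ , Κ 0ℚ ⟫ ⊠ (θˢ ⊠ θˢ) ⊞ ⟪ B , Κ 0ℚ , Κ 0ℚ ⟫ ⊠ θˢ
                           ⊞ ⟪ C , Κ 0ℚ , Κ 0ℚ ⟫)
                        ⟪ Κ 0ℚ , Κ 0ℚ , Κ 0ℚ ⟫ (env 0F 0F 0F) refl refl refl

    Tr-+ : ∀ x y → Tr (x + y) ≡ Tr x ℚ.+ Tr y
    Tr-+ x y = Ops.prove (env x y 0F) (Trˢ (X ⊞ Y)) (Trˢ X ⊕ Trˢ Y) refl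

    Tr-embed-* : ∀ q x → Tr (embed q * x) ≡ q ℚ.* Tr x
    Tr-embed-* q x = Ops.prove (env (embed q) x 0F) (Trˢ (Xℚ ⊠ Y)) (Ι (# 3) ⊗ Trˢ Y) refl

    normSq≡ : ∀ σ g → normSq σ g ≡ g * g + σ g * σ g + σ (σ g) * σ (σ g)
    normSq≡ σ g = refl

    lin≡ : ∀ n ω → lin n ω ≡ embedℤ (n zero) * ω zero + embedℤ (n (suc zero)) * ω (suc zero)
                             + embedℤ (n (suc (suc zero))) * ω (suc (suc zero))
    lin≡ n ω = refl

  embed-injective : ∀ {q r} → embed q ≡ embed r → q ≡ r
  embed-injective = cong e0

  Tr-closed-form : ∀ x → Tr x ≡ e0 x ℚ.+ e0 x ℚ.+ e0 x ℚ.+ e1 x ℚ.* ℚ.- a ℚ.+ e2 x ℚ.* (a ℚ.* a ℚ.- (b ℚ.+ b))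
  Tr-closed-form x = Ops.prove (env x 0F 0F) (Trˢ X)
    (Ι (# 3) ⊕ Ι (# 3) ⊕ Ι (# 3) ⊕ Ι (# 4) ⊗ ⊝ A ⊕ Ι (# 5) ⊗ (A ⊗ A ⊖ (B ⊕ B))) refl

  ring : CommutativeRing 0ℓ 0ℓ
  ring = record { isCommutativeRing = isCommutativeRing }

  open CommutativeRing ring public using (_-_)

  ℤ⟶F : CommutativeRing.rawRing ℤ.+-*-commutativeRing ACR.-Raw-AlmostCommutative⟶ ACR.fromCommutativeRing ring
  ℤ⟶F = record
    { ⟦_⟧    = embedℤ
    ; +-homo = λ m n → trans (cong embed (ℤ→ℚ-+ m n)) (embed-+ (ℤ→ℚ m) (ℤ→ℚ n))
    ; *-homo = λ m n → trans (cong embed (ℤ→ℚ-* m n)) (embed-* (ℤ→ℚ m) (ℤ→ℚ n))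
    ; -‿homo = λ n → trans (cong embed (ℤ→ℚ-neg n)) (embed-neg (ℤ→ℚ n))
    ; 0-homo = refl
    ; 1-homo = refl
    }

  private
    embedℤ-≟ : ∀ m n → Maybe.Maybe (embedℤ m ≡ embedℤ n)
    embedℤ-≟ m n = Maybe.map (cong embedℤ) (dec⇒maybe (m ℤ.≟ n))

  open Algebra.Solver.Ring (CommutativeRing.rawRing ℤ.+-*-commutativeRing) (ACR.fromCommutativeRing ring) ℤ⟶F embedℤ-≟ public
    using (solve; _:=_; _:+_; _:*_; :-_; _:-_; con)

  u+v+w≡0⇒w≡-u-v : ∀ u v w → u + v + w ≡ 0F → w ≡ - u - v
  u+v+w≡0⇒w≡-u-v u v w u+v+w≡0 = begin
    w                   ≡⟨ solve 3 (λ u v w → w := (u :+ v :+ w) :- u :- v) refl u v w ⟩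
    (u + v + w) - u - v ≡⟨ cong (λ s → s - u - v) u+v+w≡0 ⟩
    0F - u - v          ≡⟨ solve 2 (λ u v → con (ℤ.+ 0) :- u :- v := :- u :- v) refl u v ⟩
    - u - v             ∎
    where open ≡-Reasoning

  -- Eliminating w before calling the solver keeps its normal forms (in two variables) small.
  discriminant-identity : ∀ u v w → u + v + w ≡ 0F →
    let δ = (u - v) * (v - w) * (w - u) ; N = u * u + v * v + w * w
    in N * N * N ≡ δ * δ + δ * δ + embedℤ (ℤ.+ 54) * (u * v * w * (u * v * w))
  discriminant-identity u v w u+v+w≡0 =
    subst identity (sym (u+v+w≡0⇒w≡-u-v u v w u+v+w≡0)) (solve 2 (λ u v →
      let w = :- u :- v ; δ = (u :- v) :* (v :- w) :* (w :- u) ; N = u :* u :+ v :* v :+ w :* w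
      in N :* N :* N := δ :* δ :+ δ :* δ :+ con (ℤ.+ 54) :* (u :* v :* w :* (u :* v :* w))) refl u v)
    where
    identity : Elt → Set
    identity w = let δ = (u - v) * (v - w) * (w - u) ; N = u * u + v * v + w * w
                 in N * N * N ≡ δ * δ + δ * δ + embedℤ (ℤ.+ 54) * (u * v * w * (u * v * w))

  det3-cong : ∀ {m m′} → (∀ i j → m i j ≡ m′ i j) → det3 m ≡ det3 m′
  det3-cong eq = cong (λ rows → det3 (λ i j → lookup (lookup rows i) j)) (tabulate-cong λ i → tabulate-cong (eq i))

  Σ₃ : (Fin 3 → ℚ) → ℚ
  Σ₃ v = v zero ℚ.+ v (suc zero) ℚ.+ v (suc (suc zero))

  Σ₃-cong : ∀ {u v : Fin 3 → ℚ} → (∀ k → u k ≡ v k) → Σ₃ u ≡ Σ₃ v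
  Σ₃-cong eq = cong₃ (λ x y z → x ℚ.+ y ℚ.+ z) (eq zero) (eq (suc zero)) (eq (suc (suc zero)))

  congruence : (A G : Fin 3 → Fin 3 → ℚ) → Fin 3 → Fin 3 → ℚ
  congruence A G i j = Σ₃ λ k → A i k ℚ.* Σ₃ λ l → A j l ℚ.* G k l

  det3-congruence : ∀ A G → det3 (congruence A G) ≡ det3 A ℚ.* det3 A ℚ.* det3 G
  det3-congruence A G = Ops.prove (entries A ++ entries G)
    (det3ᴱ (λ i j → Σ₃ᴱ λ k → Aᴱ i k ⊗ Σ₃ᴱ λ l → Aᴱ j l ⊗ Gᴱ k l))
    (det3ᴱ Aᴱ ⊗ det3ᴱ Aᴱ ⊗ det3ᴱ Gᴱ) refl
    where
    entries : (Fin 3 → Fin 3 → ℚ) → Vec ℚ 9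
    entries m = concat (tabulate λ i → tabulate (m i))
    Aᴱ Gᴱ : Fin 3 → Fin 3 → Expr ℚ 18
    Aᴱ i j = Ι (combine i j ↑ˡ 9)
    Gᴱ i j = Ι (9 ↑ʳ combine i j)
    Σ₃ᴱ : (Fin 3 → Expr ℚ 18) → Expr ℚ 18
    Σ₃ᴱ v = v zero ⊕ v (suc zero) ⊕ v (suc (suc zero))
    det3ᴱ : (Fin 3 → Fin 3 → Expr ℚ 18) → Expr ℚ 18
    det3ᴱ m = m (# 0) (# 0) ⊗ (m (# 1) (# 1) ⊗ m (# 2) (# 2) ⊕ ⊝ (m (# 1) (# 2) ⊗ m (# 2) (# 1)))
            ⊕ ⊝ (m (# 0) (# 1) ⊗ (m (# 1) (# 0) ⊗ m (# 2) (# 2) ⊕ ⊝ (m (# 1) (# 2) ⊗ m (# 2) (# 0))))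
            ⊕ m (# 0) (# 2) ⊗ (m (# 1) (# 0) ⊗ m (# 2) (# 1) ⊕ ⊝ (m (# 1) (# 1) ⊗ m (# 2) (# 0)))

module Integrality (f : Cubic) where

  open Cubic f
  open Arith f
  open CubicField f
  open CommutativeRing ring using (*-identityˡ)

  1F-integral : IsIntegral 1F
  1F-integral = ℤ.-[1+ 0 ] ∷ [] , cong (_+F embedℤ ℤ.-[1+ 0 ]) (trans (sym (*≡*F 1F 1F)) (*-identityˡ 1F))

  integral-rational⇒integer : ∀ {r} → IsIntegral (embed r) → ∃ λ k → r ≡ ℤ→ℚ k
  integral-rational⇒integer {r} (cs , root) =
    rational-root-theorem cs r (embed-injective (trans (sym (embed-horner cs 1ℚ)) root))
    where
    embed-horner : ∀ cs acc → foldl (λ acc k → acc *F embed r +F embedℤ k) (embed acc) cs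
                             ≡ embed (foldl (λ acc k → acc ℚ.* r ℚ.+ ℤ→ℚ k) acc cs)
    embed-horner []       acc = refl
    embed-horner (k ∷ cs) acc = trans
      (cong (λ u → foldl (λ acc k → acc *F embed r +F embedℤ k) (u +F embedℤ k) cs)
            (trans (sym (*≡*F (embed acc) (embed r))) (sym (embed-* acc r))))
      (embed-horner cs (acc ℚ.* r ℚ.+ ℤ→ℚ k))

module Conjugation (f : Cubic) (σ : Elt → Elt)
                   (isField : Arith.IsField f) (isCyclic : Arith.IsCyclicGenerator f σ) where

  open Cubic f
  open Arith f
  open CubicField f
  open CommutativeRing ring using (+-abelianGroup; +-identityˡ; -‿inverseˡ; *-identityˡ; zeroʳ; *-comm)
  open ACR._-Raw-AlmostCommutative⟶_ ℤ⟶F using (+-homo; -‿homo)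
  open import Algebra.Properties.AbelianGroup +-abelianGroup using (identityˡ-unique; inverseˡ-unique; x∙y⁻¹≈ε⇒x≈y)
  open ≡-Reasoning

  σ-+F : ∀ x y → σ (x +F y) ≡ σ x +F σ y
  σ-+F = proj₁ (proj₁ isCyclic)

  σ-*F : ∀ x y → σ (x *F y) ≡ σ x *F σ y
  σ-*F = proj₁ (proj₂ (proj₁ isCyclic))

  σ-1 : σ 1F ≡ 1F
  σ-1 = proj₂ (proj₂ (proj₁ isCyclic))

  σ³≡id : ∀ x → σ (σ (σ x)) ≡ x
  σ³≡id = proj₁ (proj₂ isCyclic)

  σ-+ : ∀ x y → σ (x + y) ≡ σ x + σ y
  σ-+ x y = trans (cong σ (+≡+F x y)) (trans (σ-+F x y) (sym (+≡+F (σ x) (σ y))))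

  σ-* : ∀ x y → σ (x * y) ≡ σ x * σ y
  σ-* x y = trans (cong σ (*≡*F x y)) (trans (σ-*F x y) (sym (*≡*F (σ x) (σ y))))

  σ-0 : σ 0F ≡ 0F
  σ-0 = identityˡ-unique (σ 0F) (σ 0F) (trans (sym (σ-+ 0F 0F)) (cong σ (+-identityˡ 0F)))

  σ-neg : ∀ x → σ (- x) ≡ - σ x
  σ-neg x = inverseˡ-unique (σ (- x)) (σ x) (trans (sym (σ-+ (- x) x)) (trans (cong σ (-‿inverseˡ x)) σ-0))

  σ-- : ∀ x y → σ (x - y) ≡ σ x - σ y
  σ-- x y = trans (σ-+ x (- y)) (cong (σ x +_) (σ-neg y))

  σ-injective : ∀ {x y} → σ x ≡ σ y → x ≡ y
  σ-injective {x} {y} eq = trans (sym (σ³≡id x)) (trans (cong (λ z → σ (σ z)) eq) (σ³≡id y))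

  σ²-* : ∀ x y → σ (σ (x * y)) ≡ σ (σ x) * σ (σ y)
  σ²-* x y = trans (cong σ (σ-* x y)) (σ-* (σ x) (σ y))

  σ-embedℕ : ∀ n → σ (embedℤ (ℤ.+ n)) ≡ embedℤ (ℤ.+ n)
  σ-embedℕ zero    = σ-0
  σ-embedℕ (suc n) = begin
    σ (embedℤ (ℤ.+ 1 ℤ.+ ℤ.+ n))    ≡⟨ cong σ (+-homo (ℤ.+ 1) (ℤ.+ n)) ⟩
    σ (1F + embedℤ (ℤ.+ n))          ≡⟨ σ-+ 1F (embedℤ (ℤ.+ n)) ⟩
    σ 1F + σ (embedℤ (ℤ.+ n))        ≡⟨ cong₂ _+_ σ-1 (σ-embedℕ n) ⟩
    1F + embedℤ (ℤ.+ n)              ≡⟨ +-homo (ℤ.+ 1) (ℤ.+ n) ⟨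
    embedℤ (ℤ.+ suc n)               ∎

  σ-embedℤ : ∀ k → σ (embedℤ k) ≡ embedℤ k
  σ-embedℤ (ℤ.+ n)    = σ-embedℕ n
  σ-embedℤ ℤ.-[1+ n ] = begin
    σ (embedℤ (ℤ.- ℤ.+ suc n))       ≡⟨ cong σ (-‿homo (ℤ.+ suc n)) ⟩
    σ (- embedℤ (ℤ.+ suc n))         ≡⟨ σ-neg (embedℤ (ℤ.+ suc n)) ⟩
    - σ (embedℤ (ℤ.+ suc n))         ≡⟨ cong -_ (σ-embedℕ (suc n)) ⟩
    - embedℤ (ℤ.+ suc n)             ≡⟨ -‿homo (ℤ.+ suc n) ⟨
    embedℤ ℤ.-[1+ n ]                ∎

  inverse : ∀ {x} → x ≢ 0F → ∃ λ y → x * y ≡ 1F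
  inverse {x} x≢0 with isField x x≢0
  ... | y , xy≡1 = y , trans (*≡*F x y) xy≡1

  *-cancelˡ-≢0 : ∀ {x y z} → x ≢ 0F → x * y ≡ x * z → y ≡ z
  *-cancelˡ-≢0 {x} {y} {z} x≢0 xy≡xz with inverse x≢0
  ... | x⁻¹ , xx⁻¹≡1 = begin
    y                  ≡⟨ *-identityˡ y ⟨
    1F * y             ≡⟨ cong (_* y) xx⁻¹≡1 ⟨
    (x * x⁻¹) * y      ≡⟨ solve 3 (λ x i y → (x :* i) :* y := i :* (x :* y)) refl x x⁻¹ y ⟩
    x⁻¹ * (x * y)      ≡⟨ cong (x⁻¹ *_) xy≡xz ⟩
    x⁻¹ * (x * z)      ≡⟨ solve 3 (λ x i z → i :* (x :* z) := (x :* i) :* z) refl x x⁻¹ z ⟩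
    (x * x⁻¹) * z      ≡⟨ cong (_* z) xx⁻¹≡1 ⟩
    1F * z             ≡⟨ *-identityˡ z ⟩
    z                  ∎

  x*y≡0⇒y≡0 : ∀ {x y} → x ≢ 0F → x * y ≡ 0F → y ≡ 0F
  x*y≡0⇒y≡0 {x} x≢0 xy≡0 = *-cancelˡ-≢0 x≢0 (trans xy≡0 (sym (zeroʳ x)))

  x≢0∧y≢0⇒x*y≢0 : ∀ {x y} → x ≢ 0F → y ≢ 0F → x * y ≢ 0F
  x≢0∧y≢0⇒x*y≢0 x≢0 y≢0 xy≡0 = y≢0 (x*y≡0⇒y≡0 x≢0 xy≡0)

  x≢y⇒x-y≢0 : ∀ {x y} → x ≢ y → x - y ≢ 0F
  x≢y⇒x-y≢0 x≢y x-y≡0 = x≢y (x∙y⁻¹≈ε⇒x≈y _ _ x-y≡0)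

  σ-embed : ∀ q → σ (embed q) ≡ embed q
  σ-embed q = *-cancelˡ-≢0 d≢0 (begin
    d * σ (embed q)          ≡⟨ cong (_* σ (embed q)) (σ-embedℤ (↧ q)) ⟨
    σ d * σ (embed q)        ≡⟨ σ-* d (embed q) ⟨
    σ (d * embed q)          ≡⟨ cong σ d*q≡n ⟩
    σ (embedℤ (↥ q))         ≡⟨ σ-embedℤ (↥ q) ⟩
    embedℤ (↥ q)             ≡⟨ d*q≡n ⟨
    d * embed q              ∎)
    where
    d = embedℤ (↧ q)
    d*q≡n : d * embed q ≡ embedℤ (↥ q)
    d*q≡n = trans (*-comm d (embed q)) (trans (sym (embed-* q (ℤ→ℚ (↧ q)))) (cong embed (q*↧q≡↥q q)))
    d≢0 : d ≢ 0F
    d≢0 d≡0 with ℤ→ℚ-injective {↧ q} {ℤ.+ 0} (cong e0 d≡0)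
    ... | ()

  σ-embed-* : ∀ q x → σ (embed q * x) ≡ embed q * σ x
  σ-embed-* q x = trans (σ-* (embed q) x) (cong (_* σ x) (σ-embed q))

  minpoly : Elt → Elt
  minpoly x = x * x * x + embed a * (x * x) + embed b * x + embed c

  σ-minpoly : ∀ x → σ (minpoly x) ≡ minpoly (σ x)
  σ-minpoly x = begin
    σ (minpoly x)
      ≡⟨ trans (σ-+ _ _) (cong₂ _+_ (trans (σ-+ _ _) (cong₂ _+_ (σ-+ _ _) refl)) refl) ⟩
    σ (x * x * x) + σ (embed a * (x * x)) + σ (embed b * x) + σ (embed c)
      ≡⟨ cong₂ _+_ (cong₂ _+_ (cong₂ _+_ cube (trans (σ-embed-* a (x * x)) (cong (embed a *_) (σ-* x x))))
                                (σ-embed-* b x))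
                     (σ-embed c) ⟩
    minpoly (σ x) ∎
    where
    cube : σ (x * x * x) ≡ σ x * σ x * σ x
    cube = trans (σ-* (x * x) x) (cong (_* σ x) (σ-* x x))

  θ₁ θ₂ : Elt
  θ₁ = σ θ
  θ₂ = σ θ₁

  minpoly-θ₁ : minpoly θ₁ ≡ 0F
  minpoly-θ₁ = trans (sym (σ-minpoly θ)) (trans (cong σ θ-root) σ-0)

  minpoly-θ₂ : minpoly θ₂ ≡ 0F
  minpoly-θ₂ = trans (sym (σ-minpoly θ₁)) (trans (cong σ minpoly-θ₁) σ-0)

  -- σ is determined by σ θ, since 1, θ, θ² span F over the rationals fixed by σ.
  σθ≢θ : θ₁ ≢ θ
  σθ≢θ σθ≡θ with proj₂ (proj₂ isCyclic)
  ... | x , σx≢x = σx≢x (begin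
    σ x
      ≡⟨ cong σ (θ-basis x) ⟨
    σ (embed (e0 x) + embed (e1 x) * θ + embed (e2 x) * (θ * θ))
      ≡⟨ trans (σ-+ _ _) (cong₂ _+_ (trans (σ-+ _ _) (cong₂ _+_ (σ-embed (e0 x)) (σ-embed-* (e1 x) θ)))
                                      (trans (σ-embed-* (e2 x) (θ * θ)) (cong (embed (e2 x) *_) (σ-* θ θ)))) ⟩
    embed (e0 x) + embed (e1 x) * θ₁ + embed (e2 x) * (θ₁ * θ₁)
      ≡⟨ cong (λ y → embed (e0 x) + embed (e1 x) * y + embed (e2 x) * (y * y)) σθ≡θ ⟩
    embed (e0 x) + embed (e1 x) * θ + embed (e2 x) * (θ * θ)
      ≡⟨ θ-basis x ⟩
    x ∎)

  θ≢θ₁ : θ ≢ θ₁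
  θ≢θ₁ eq = σθ≢θ (sym eq)

  θ₁≢θ₂ : θ₁ ≢ θ₂
  θ₁≢θ₂ eq = σθ≢θ (sym (σ-injective eq))

  θ≢θ₂ : θ ≢ θ₂
  θ≢θ₂ eq = σθ≢θ (trans (cong σ eq) (σ³≡id θ))

  divided-difference : Elt → Elt → Elt
  divided-difference x y = x * x + x * y + y * y + embed a * (x + y) + embed b

  common-roots⇒divided-difference≡0 : ∀ {x y} → x ≢ y → minpoly x ≡ 0F → minpoly y ≡ 0F →
                                       divided-difference x y ≡ 0F
  common-roots⇒divided-difference≡0 {x} {y} x≢y x-root y-root = x*y≡0⇒y≡0 (x≢y⇒x-y≢0 x≢y) (begin
    (x - y) * divided-difference x y
      ≡⟨ solve 5 (λ x y A B C → (x :- y) :* (x :* x :+ x :* y :+ y :* y :+ A :* (x :+ y) :+ B)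
                       := (x :* x :* x :+ A :* (x :* x) :+ B :* x :+ C) :- (y :* y :* y :+ A :* (y :* y) :+ B :* y :+ C))
                 refl x y (embed a) (embed b) (embed c) ⟩
    minpoly x - minpoly y ≡⟨ cong₂ _-_ x-root y-root ⟩
    0F - 0F               ≡⟨ -‿inverseʳ 0F ⟩
    0F                    ∎)
    where open CommutativeRing ring using (-‿inverseʳ)

  vieta-sum : θ + θ₁ + θ₂ + embed a ≡ 0F
  vieta-sum = x*y≡0⇒y≡0 (x≢y⇒x-y≢0 θ₁≢θ₂) (begin
    (θ₁ - θ₂) * (θ + θ₁ + θ₂ + embed a)
      ≡⟨ solve 5 (λ x y z A B → (y :- z) :* (x :+ y :+ z :+ A)
                       := (x :* x :+ x :* y :+ y :* y :+ A :* (x :+ y) :+ B) :- (x :* x :+ x :* z :+ z :* z :+ A :* (x :+ z) :+ B))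
                 refl θ θ₁ θ₂ (embed a) (embed b) ⟩
    divided-difference θ θ₁ - divided-difference θ θ₂
      ≡⟨ cong₂ _-_ (common-roots⇒divided-difference≡0 θ≢θ₁ θ-root minpoly-θ₁)
                   (common-roots⇒divided-difference≡0 θ≢θ₂ θ-root minpoly-θ₂) ⟩
    0F - 0F ≡⟨ -‿inverseʳ 0F ⟩
    0F ∎)
    where open CommutativeRing ring using (-‿inverseʳ)

  vieta-squares : θ * θ + θ₁ * θ₁ + θ₂ * θ₂ ≡ embed a * embed a - (embed b + embed b)
  vieta-squares = begin
    θ * θ + θ₁ * θ₁ + θ₂ * θ₂
      ≡⟨ solve 5 (λ x y z A B → x :* x :+ y :* y :+ z :* z
                      := A :* A :- (B :+ B) :+ con (ℤ.+ 2) :* (x :* x :+ x :* y :+ y :* y :+ A :* (x :+ y) :+ B)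
                         :+ (z :- A :- x :- y) :* (x :+ y :+ z :+ A))
                 refl θ θ₁ θ₂ (embed a) (embed b) ⟩
    embed a * embed a - (embed b + embed b) + embedℤ (ℤ.+ 2) * divided-difference θ θ₁
      + (θ₂ - embed a - θ - θ₁) * (θ + θ₁ + θ₂ + embed a)
      ≡⟨ cong₂ (λ u v → embed a * embed a - (embed b + embed b) + embedℤ (ℤ.+ 2) * u + (θ₂ - embed a - θ - θ₁) * v)
               (common-roots⇒divided-difference≡0 θ≢θ₁ θ-root minpoly-θ₁) vieta-sum ⟩
    embed a * embed a - (embed b + embed b) + embedℤ (ℤ.+ 2) * 0F + (θ₂ - embed a - θ - θ₁) * 0F
      ≡⟨ solve 4 (λ A B w t → A :* A :- (B :+ B) :+ t :* con (ℤ.+ 0) :+ w :* con (ℤ.+ 0) := A :* A :- (B :+ B))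
               refl (embed a) (embed b) (θ₂ - embed a - θ - θ₁) (embedℤ (ℤ.+ 2)) ⟩
    embed a * embed a - (embed b + embed b) ∎

  conj-sum : Elt → Elt
  conj-sum x = x + σ x + σ (σ x)

  conj-sum-+ : ∀ x y → conj-sum (x + y) ≡ conj-sum x + conj-sum y
  conj-sum-+ x y = begin
    (x + y) + σ (x + y) + σ (σ (x + y))
      ≡⟨ cong₂ (λ u v → (x + y) + u + v) (σ-+ x y) (trans (cong σ (σ-+ x y)) (σ-+ (σ x) (σ y))) ⟩
    (x + y) + (σ x + σ y) + (σ (σ x) + σ (σ y))
      ≡⟨ solve 6 (λ x y x₁ y₁ x₂ y₂ → (x :+ y) :+ (x₁ :+ y₁) :+ (x₂ :+ y₂) := (x :+ x₁ :+ x₂) :+ (y :+ y₁ :+ y₂))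
               refl x y (σ x) (σ y) (σ (σ x)) (σ (σ y)) ⟩
    conj-sum x + conj-sum y ∎

  conj-sum-embed-* : ∀ q x → conj-sum (embed q * x) ≡ embed q * conj-sum x
  conj-sum-embed-* q x = begin
    embed q * x + σ (embed q * x) + σ (σ (embed q * x))
      ≡⟨ cong₂ (λ u v → embed q * x + u + v) (σ-embed-* q x) (trans (cong σ (σ-embed-* q x)) (σ-embed-* q (σ x))) ⟩
    embed q * x + embed q * σ x + embed q * σ (σ x)
      ≡⟨ solve 4 (λ q x x₁ x₂ → q :* x :+ q :* x₁ :+ q :* x₂ := q :* (x :+ x₁ :+ x₂)) refl (embed q) x (σ x) (σ (σ x)) ⟩
    embed q * conj-sum x ∎

  conj-sum-embed : ∀ q → conj-sum (embed q) ≡ embed (q ℚ.+ q ℚ.+ q)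
  conj-sum-embed q = begin
    embed q + σ (embed q) + σ (σ (embed q))
      ≡⟨ cong₂ (λ u v → embed q + u + v) (σ-embed q) (trans (cong σ (σ-embed q)) (σ-embed q)) ⟩
    embed q + embed q + embed q
      ≡⟨ trans (embed-+ (q ℚ.+ q) q) (cong (_+ embed q) (embed-+ q q)) ⟨
    embed (q ℚ.+ q ℚ.+ q) ∎

  conj-sum-θ : conj-sum θ ≡ embed (ℚ.- a)
  conj-sum-θ = trans (inverseˡ-unique (θ + θ₁ + θ₂) (embed a) vieta-sum) (sym (embed-neg a))

  conj-sum-θ² : conj-sum (θ * θ) ≡ embed (a ℚ.* a ℚ.- (b ℚ.+ b))
  conj-sum-θ² = begin
    θ * θ + σ (θ * θ) + σ (σ (θ * θ))           ≡⟨ cong₂ (λ u v → θ * θ + u + v) (σ-* θ θ) (σ²-* θ θ) ⟩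
    θ * θ + θ₁ * θ₁ + θ₂ * θ₂                   ≡⟨ vieta-squares ⟩
    embed a * embed a - (embed b + embed b)     ≡⟨ trans (embed-- (a ℚ.* a) (b ℚ.+ b)) (cong₂ _-_ (embed-* a a) (embed-+ b b)) ⟨
    embed (a ℚ.* a ℚ.- (b ℚ.+ b))               ∎

  conj-sum≡Tr : ∀ x → conj-sum x ≡ embed (Tr x)
  conj-sum≡Tr x = begin
    conj-sum x
      ≡⟨ cong conj-sum (θ-basis x) ⟨
    conj-sum (embed x0 + embed x1 * θ + embed x2 * (θ * θ))
      ≡⟨ trans (conj-sum-+ _ _) (cong₂ _+_ (conj-sum-+ _ _) refl) ⟩
    conj-sum (embed x0) + conj-sum (embed x1 * θ) + conj-sum (embed x2 * (θ * θ))
      ≡⟨ cong₂ _+_ (cong₂ _+_ (conj-sum-embed x0) (trans (conj-sum-embed-* x1 θ) (cong (embed x1 *_) conj-sum-θ)))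
                   (trans (conj-sum-embed-* x2 (θ * θ)) (cong (embed x2 *_) conj-sum-θ²)) ⟩
    embed (x0 ℚ.+ x0 ℚ.+ x0) + embed x1 * embed (ℚ.- a) + embed x2 * embed (a ℚ.* a ℚ.- (b ℚ.+ b))
      ≡⟨ cong₂ (λ u v → embed (x0 ℚ.+ x0 ℚ.+ x0) + u + v) (embed-* x1 (ℚ.- a)) (embed-* x2 _) ⟨
    embed (x0 ℚ.+ x0 ℚ.+ x0) + embed (x1 ℚ.* ℚ.- a) + embed (x2 ℚ.* (a ℚ.* a ℚ.- (b ℚ.+ b)))
      ≡⟨ trans (embed-+ _ _) (cong (_+ embed (x2 ℚ.* (a ℚ.* a ℚ.- (b ℚ.+ b)))) (embed-+ _ _)) ⟨
    embed (x0 ℚ.+ x0 ℚ.+ x0 ℚ.+ x1 ℚ.* ℚ.- a ℚ.+ x2 ℚ.* (a ℚ.* a ℚ.- (b ℚ.+ b)))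
      ≡⟨ cong embed (Tr-closed-form x) ⟨
    embed (Tr x) ∎
    where
    x0 = e0 x
    x1 = e1 x
    x2 = e2 x

  Tr-σ : ∀ x → Tr (σ x) ≡ Tr x
  Tr-σ x = embed-injective (begin
    embed (Tr (σ x))                    ≡⟨ conj-sum≡Tr (σ x) ⟨
    σ x + σ (σ x) + σ (σ (σ x))         ≡⟨ cong (σ x + σ (σ x) +_) (σ³≡id x) ⟩
    σ x + σ (σ x) + x                   ≡⟨ solve 3 (λ x x₁ x₂ → x₁ :+ x₂ :+ x := x :+ x₁ :+ x₂) refl x (σ x) (σ (σ x)) ⟩
    conj-sum x                          ≡⟨ conj-sum≡Tr x ⟩
    embed (Tr x)                        ∎)

  σ-fixed⇒rational : ∀ {y} → σ y ≡ y → ∃ λ q → y ≡ embed q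
  σ-fixed⇒rational {y} σy≡y = ⅓ ℚ.* Tr y , (begin
    y                                   ≡⟨ *-identityˡ y ⟨
    1F * y                              ≡⟨ cong (_* y) (embed-* ⅓ (ℤ→ℚ (ℤ.+ 3))) ⟩
    embed ⅓ * embedℤ (ℤ.+ 3) * y        ≡⟨ solve 2 (λ t y → t :* con (ℤ.+ 3) :* y := t :* (y :+ y :+ y)) refl (embed ⅓) y ⟩
    embed ⅓ * (y + y + y)               ≡⟨ cong₂ (λ u v → embed ⅓ * (y + u + v)) σy≡y (trans (cong σ σy≡y) σy≡y) ⟨
    embed ⅓ * conj-sum y                ≡⟨ cong (embed ⅓ *_) (conj-sum≡Tr y) ⟩
    embed ⅓ * embed (Tr y)              ≡⟨ embed-* ⅓ (Tr y) ⟨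
    embed (⅓ ℚ.* Tr y)                  ∎)

  σ-fixed-integral⇒integer : ∀ {x} → IsIntegral x → σ x ≡ x → ∃ λ k → x ≡ embedℤ k
  σ-fixed-integral⇒integer {x} x-integral σx≡x = integer (σ-fixed⇒rational σx≡x)
    where
    integer : (∃ λ r → x ≡ embed r) → ∃ λ k → x ≡ embedℤ k
    integer (r , x≡r) = proj₁ r-integer , trans x≡r (cong embed (proj₂ r-integer))
      where
      r-integer : ∃ λ k → r ≡ ℤ→ℚ k
      r-integer = Integrality.integral-rational⇒integer f (subst IsIntegral x≡r x-integral)

  σ-integral : ∀ {x} → IsIntegral x → IsIntegral (σ x)
  σ-integral {x} (cs , root) = cs , (begin
    evalMonic cs (σ x)                                  ≡⟨ cong (λ u → foldl (step (σ x)) u cs) σ-1 ⟨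
    foldl (step (σ x)) (σ 1F) cs                        ≡⟨ σ-foldl cs 1F ⟨
    σ (evalMonic cs x)                                  ≡⟨ cong σ root ⟩
    σ 0F                                                ≡⟨ σ-0 ⟩
    0F                                                  ∎)
    where
    step : Elt → Elt → ℤ → Elt
    step y acc k = acc *F y +F embedℤ k
    σ-foldl : ∀ cs acc → σ (foldl (step x) acc cs) ≡ foldl (step (σ x)) (σ acc) cs
    σ-foldl []       acc = refl
    σ-foldl (k ∷ cs) acc = trans (σ-foldl cs (step x acc k))
      (cong (λ u → foldl (step (σ x)) u cs) (trans (σ-+F _ _) (cong₂ _+F_ (σ-*F acc x) (σ-embedℤ k))))

module ElementConjugates (f : Cubic) (σ : Elt → Elt)
                  (isField : Arith.IsField f) (isCyclic : Arith.IsCyclicGenerator f σ) (g : Elt) where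

  open Cubic f
  open Arith f
  open CubicField f
  open Conjugation f σ isField isCyclic
  open CommutativeRing ring using (*-comm; *-identityˡ; *-identityʳ)
  open ≡-Reasoning

  g₁ g₂ : Elt
  g₁ = σ g
  g₂ = σ g₁

  t M P : ℚ
  t = Tr g
  M = Tr (g * g)
  P = Tr (g * g₁)

  sum-g : g + g₁ + g₂ ≡ embed t
  sum-g = conj-sum≡Tr g

  sum-g² : g * g + g₁ * g₁ + g₂ * g₂ ≡ embed M
  sum-g² = trans (cong₂ (λ u v → g * g + u + v) (sym (σ-* g g)) (sym (σ²-* g g))) (conj-sum≡Tr (g * g))

  sum-gg₁ : g * g₁ + g₁ * g₂ + g₂ * g ≡ embed P
  sum-gg₁ = trans (cong₂ (λ u v → g * g₁ + u + v) (sym (σ-* g g₁)) (sym (trans (σ²-* g g₁) (cong (g₂ *_) (σ³≡id g)))))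
                  (conj-sum≡Tr (g * g₁))

  private
    square-of-sum : ∀ x y z → (x + y + z) * (x + y + z)
                            ≡ (x * x + y * y + z * z) + ((x * y + y * z + z * x) + (x * y + y * z + z * x))
    square-of-sum = solve 3 (λ x y z → (x :+ y :+ z) :* (x :+ y :+ z)
                                 := (x :* x :+ y :* y :+ z :* z) :+ ((x :* y :+ y :* z :+ z :* x) :+ (x :* y :+ y :* z :+ z :* x))) refl

    squared-differences : ∀ x y z → (x - y) * (x - y) + (y - z) * (y - z) + (z - x) * (z - x)
                                  ≡ (x * x + y * y + z * z) - (x * y + y * z + z * x) + ((x * x + y * y + z * z) - (x * y + y * z + z * x))
    squared-differences = solve 3 (λ x y z → (x :- y) :* (x :- y) :+ (y :- z) :* (y :- z) :+ (z :- x) :* (z :- x)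
                                     := (x :* x :+ y :* y :+ z :* z) :- (x :* y :+ y :* z :+ z :* x)
                                        :+ ((x :* x :+ y :* y :+ z :* z) :- (x :* y :+ y :* z :+ z :* x))) refl

    differences-sum : ∀ x y z → (x - y) + (y - z) + (z - x) ≡ 0F
    differences-sum = solve 3 (λ x y z → (x :- y) :+ (y :- z) :+ (z :- x) := con (ℤ.+ 0)) refl

    rotate : ∀ x y z → x * y * z ≡ z * x * y
    rotate = solve 3 (λ x y z → x :* y :* z := z :* x :* y) refl

  t*t≡M+2P : t ℚ.* t ≡ M ℚ.+ (P ℚ.+ P)
  t*t≡M+2P = embed-injective (begin
    embed (t ℚ.* t)
      ≡⟨ embed-* t t ⟩
    embed t * embed t
      ≡⟨ cong₂ _*_ sum-g sum-g ⟨
    (g + g₁ + g₂) * (g + g₁ + g₂)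
      ≡⟨ square-of-sum g g₁ g₂ ⟩
    (g * g + g₁ * g₁ + g₂ * g₂) + ((g * g₁ + g₁ * g₂ + g₂ * g) + (g * g₁ + g₁ * g₂ + g₂ * g))
      ≡⟨ cong₂ _+_ sum-g² (cong₂ _+_ sum-gg₁ sum-gg₁) ⟩
    embed M + (embed P + embed P)
      ≡⟨ trans (embed-+ M (P ℚ.+ P)) (cong (embed M +_) (embed-+ P P)) ⟨
    embed (M ℚ.+ (P ℚ.+ P)) ∎)

  u v w δ e : Elt
  u = g - g₁
  v = g₁ - g₂
  w = g₂ - g
  δ = (u - v) * (v - w) * (w - u)
  e = u * v * w

  N : ℚ
  N = (M ℚ.- P) ℚ.+ (M ℚ.- P)

  σu≡v : σ u ≡ v
  σu≡v = σ-- g g₁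

  σv≡w : σ v ≡ w
  σv≡w = trans (σ-- g₁ g₂) (cong (λ y → g₂ - y) (σ³≡id g))

  σw≡u : σ w ≡ u
  σw≡u = trans (σ-- g₂ g) (cong (_- g₁) (σ³≡id g))

  σδ≡δ : σ δ ≡ δ
  σδ≡δ = begin
    σ δ                                           ≡⟨ trans (σ-* _ _) (cong (_* σ (w - u)) (σ-* _ _)) ⟩
    σ (u - v) * σ (v - w) * σ (w - u)             ≡⟨ cong₂ _*_ (cong₂ _*_ (σ-- u v) (σ-- v w)) (σ-- w u) ⟩
    (σ u - σ v) * (σ v - σ w) * (σ w - σ u)       ≡⟨ cong₃ (λ x y z → (x - y) * (y - z) * (z - x)) σu≡v σv≡w σw≡u ⟩
    (v - w) * (w - u) * (u - v)                   ≡⟨ rotate (v - w) (w - u) (u - v) ⟩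
    δ                                             ∎

  σe≡e : σ e ≡ e
  σe≡e = begin
    σ e                   ≡⟨ trans (σ-* _ _) (cong (_* σ w) (σ-* u v)) ⟩
    σ u * σ v * σ w       ≡⟨ cong₃ (λ x y z → x * y * z) σu≡v σv≡w σw≡u ⟩
    v * w * u             ≡⟨ rotate v w u ⟩
    e                     ∎

  e≢0 : g₁ ≢ g → e ≢ 0F
  e≢0 g₁≢g = x≢0∧y≢0⇒x*y≢0 (x≢0∧y≢0⇒x*y≢0 u≢0 (subst (_≢ 0F) σu≡v (σ-≢0 u≢0)))
                           (subst (_≢ 0F) (trans (cong σ σu≡v) σv≡w) (σ-≢0 (σ-≢0 u≢0)))
    where
    u≢0 : u ≢ 0F
    u≢0 = x≢y⇒x-y≢0 (λ g≡g₁ → g₁≢g (sym g≡g₁))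
    σ-≢0 : ∀ {x} → x ≢ 0F → σ x ≢ 0F
    σ-≢0 x≢0 σx≡0 = x≢0 (σ-injective (trans σx≡0 (sym σ-0)))

  u²+v²+w²≡N : u * u + v * v + w * w ≡ embed N
  u²+v²+w²≡N = begin
    u * u + v * v + w * w
      ≡⟨ squared-differences g g₁ g₂ ⟩
    (g * g + g₁ * g₁ + g₂ * g₂) - (g * g₁ + g₁ * g₂ + g₂ * g)
      + ((g * g + g₁ * g₁ + g₂ * g₂) - (g * g₁ + g₁ * g₂ + g₂ * g))
      ≡⟨ cong₂ (λ m p → m - p + (m - p)) sum-g² sum-gg₁ ⟩
    embed M - embed P + (embed M - embed P)
      ≡⟨ trans (embed-+ (M ℚ.- P) (M ℚ.- P)) (cong₂ _+_ (embed-- M P) (embed-- M P)) ⟨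
    embed N ∎

  N³≡2δ²+54e² : ∀ {δq eq} → δ ≡ embed δq → e ≡ embed eq →
                N ℚ.* N ℚ.* N ≡ δq ℚ.* δq ℚ.+ δq ℚ.* δq ℚ.+ ℤ→ℚ (ℤ.+ 54) ℚ.* (eq ℚ.* eq)
  N³≡2δ²+54e² {δq} {eq} δ≡δq e≡eq = embed-injective (begin
    embed (N ℚ.* N ℚ.* N)
      ≡⟨ trans (embed-* (N ℚ.* N) N) (cong (_* embed N) (embed-* N N)) ⟩
    embed N * embed N * embed N
      ≡⟨ cong (λ n → n * n * n) u²+v²+w²≡N ⟨
    (u * u + v * v + w * w) * (u * u + v * v + w * w) * (u * u + v * v + w * w)
      ≡⟨ discriminant-identity u v w (differences-sum g g₁ g₂) ⟩
    δ * δ + δ * δ + embedℤ (ℤ.+ 54) * (e * e)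
      ≡⟨ cong₂ (λ d e → d * d + d * d + embedℤ (ℤ.+ 54) * (e * e)) δ≡δq e≡eq ⟩
    embed δq * embed δq + embed δq * embed δq + embedℤ (ℤ.+ 54) * (embed eq * embed eq)
      ≡⟨ cong₂ (λ d e → d + d + embedℤ (ℤ.+ 54) * e) (embed-* δq δq) (embed-* eq eq) ⟨
    embed D + embed D + embed k54 * embed E
      ≡⟨ cong₂ _+_ (embed-+ D D) (embed-* k54 E) ⟨
    embed (D ℚ.+ D) + embed (k54 ℚ.* E)
      ≡⟨ embed-+ (D ℚ.+ D) (k54 ℚ.* E) ⟨
    embed (D ℚ.+ D ℚ.+ k54 ℚ.* E) ∎)
    where
    D E k54 : ℚ
    D = δq ℚ.* δq
    E = eq ℚ.* eq
    k54 = ℤ→ℚ (ℤ.+ 54)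

  0<N³ : g₁ ≢ g → ∀ {δq eq} → δ ≡ embed δq → e ≡ embed eq → 0ℚ ℚ.< N ℚ.* N ℚ.* N
  0<N³ g₁≢g {δq} {eq} δ≡δq e≡eq = subst (0ℚ ℚ.<_) (sym (N³≡2δ²+54e² δ≡δq e≡eq))
    (0<x*x+x*x+54*y*y δq {eq} λ eq≡0 → e≢0 g₁≢g (trans e≡eq (cong embed eq≡0)))

  -- The conjugates of g are not real numbers in this setting, so 2 (M - P) = Σ (gᵢ - gᵢ₊₁)² is shown
  -- positive through its cube, which the discriminant identity writes as a sum of rational squares.
  0<M-P : g₁ ≢ g → 0ℚ ℚ.< M ℚ.- P
  0<M-P g₁≢g = 0<x+x⇒0<x {M ℚ.- P}
    (0<x*x*x⇒0<x N (0<N³ g₁≢g (proj₂ (σ-fixed⇒rational σδ≡δ)) (proj₂ (σ-fixed⇒rational σe≡e))))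

  family : Fin 3 → Elt
  family zero             = 1F
  family (suc zero)       = g
  family (suc (suc zero)) = g₁

  det-gram-family : det3 (λ i j → Tr (family i *F family j)) ≡ (M ℚ.- P) ℚ.* (M ℚ.- P)
  det-gram-family = begin
    det3 (λ i j → Tr (family i *F family j))
      ≡⟨ det3-cong entries ⟩
    ℤ→ℚ (ℤ.+ 3) ℚ.* (M ℚ.* M ℚ.- P ℚ.* P) ℚ.- t ℚ.* (t ℚ.* M ℚ.- P ℚ.* t) ℚ.+ t ℚ.* (t ℚ.* P ℚ.- M ℚ.* t)
      ≡⟨ expand t M P ⟩
    (M ℚ.- P) ℚ.* (ℤ→ℚ (ℤ.+ 3) ℚ.* (M ℚ.+ P) ℚ.- (t ℚ.* t ℚ.+ t ℚ.* t))
      ≡⟨ cong (λ s → (M ℚ.- P) ℚ.* (ℤ→ℚ (ℤ.+ 3) ℚ.* (M ℚ.+ P) ℚ.- (s ℚ.+ s))) t*t≡M+2P ⟩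
    (M ℚ.- P) ℚ.* (ℤ→ℚ (ℤ.+ 3) ℚ.* (M ℚ.+ P) ℚ.- ((M ℚ.+ (P ℚ.+ P)) ℚ.+ (M ℚ.+ (P ℚ.+ P))))
      ≡⟨ simplify M P ⟩
    (M ℚ.- P) ℚ.* (M ℚ.- P) ∎
    where
    gram : Fin 3 → Fin 3 → ℚ
    gram zero             zero             = ℤ→ℚ (ℤ.+ 3)
    gram zero             (suc _)          = t
    gram (suc _)          zero             = t
    gram (suc zero)       (suc zero)       = M
    gram (suc (suc zero)) (suc (suc zero)) = M
    gram (suc zero)       (suc (suc zero)) = P
    gram (suc (suc zero)) (suc zero)       = P
    Tr-*F : ∀ x y → Tr (x *F y) ≡ Tr (x * y)
    Tr-*F x y = cong Tr (sym (*≡*F x y))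
    entries : ∀ i j → Tr (family i *F family j) ≡ gram i j
    entries zero             zero             = trans (Tr-*F 1F 1F) (trans (cong Tr (*-identityˡ 1F))
                                                  (embed-injective (trans (sym (conj-sum≡Tr 1F)) (conj-sum-embed 1ℚ))))
    entries zero             (suc zero)       = trans (Tr-*F 1F g) (cong Tr (*-identityˡ g))
    entries zero             (suc (suc zero)) = trans (Tr-*F 1F g₁) (trans (cong Tr (*-identityˡ g₁)) (Tr-σ g))
    entries (suc zero)       zero             = trans (Tr-*F g 1F) (cong Tr (*-identityʳ g))
    entries (suc (suc zero)) zero             = trans (Tr-*F g₁ 1F) (trans (cong Tr (*-identityʳ g₁)) (Tr-σ g))
    entries (suc zero)       (suc zero)       = Tr-*F g g
    entries (suc zero)       (suc (suc zero)) = Tr-*F g g₁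
    entries (suc (suc zero)) (suc zero)       = trans (Tr-*F g₁ g) (cong Tr (*-comm g₁ g))
    entries (suc (suc zero)) (suc (suc zero)) = trans (Tr-*F g₁ g₁) (trans (cong Tr (sym (σ-* g g))) (Tr-σ (g * g)))
    expand : ∀ t M P → ℤ→ℚ (ℤ.+ 3) ℚ.* (M ℚ.* M ℚ.- P ℚ.* P) ℚ.- t ℚ.* (t ℚ.* M ℚ.- P ℚ.* t)
                         ℚ.+ t ℚ.* (t ℚ.* P ℚ.- M ℚ.* t)
                     ≡ (M ℚ.- P) ℚ.* (ℤ→ℚ (ℤ.+ 3) ℚ.* (M ℚ.+ P) ℚ.- (t ℚ.* t ℚ.+ t ℚ.* t))
    expand = solve-∀ ℚ-almostCommutativeRing
    simplify : ∀ M P → (M ℚ.- P) ℚ.* (ℤ→ℚ (ℤ.+ 3) ℚ.* (M ℚ.+ P) ℚ.- ((M ℚ.+ (P ℚ.+ P)) ℚ.+ (M ℚ.+ (P ℚ.+ P))))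
                       ≡ (M ℚ.- P) ℚ.* (M ℚ.- P)
    simplify = solve-∀ ℚ-almostCommutativeRing

  family-integral : IsIntegral g → ∀ i → IsIntegral (family i)
  family-integral g-integral zero             = Integrality.1F-integral f
  family-integral g-integral (suc zero)       = g-integral
  family-integral g-integral (suc (suc zero)) = σ-integral g-integral

  non-integer⇒σg≢g : IsIntegral g → (∀ n → g ≢ embedℤ n) → g₁ ≢ g
  non-integer⇒σg≢g g-integral g∉ℤ σg≡g = g∉ℤ (proj₁ integer) (proj₂ integer)
    where
    integer : ∃ λ k → g ≡ embedℤ k
    integer = σ-fixed-integral⇒integer g-integral σg≡g

module Lattice (f : Cubic) (ω : Fin 3 → Elt) where

  open Arith f
  open CubicField f
  open CommutativeRing ring using (*-comm)
  open ≡-Reasoning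

  det3-integer : ∀ {m} → (∀ i j → IsInteger (m i j)) → IsInteger (det3 m)
  det3-integer {m} h =
    integer-+ (integer-- (integer-* (h (# 0) (# 0)) (minor (# 1) (# 2) (# 1) (# 2)))
                         (integer-* (h (# 0) (# 1)) (minor (# 1) (# 2) (# 0) (# 2))))
              (integer-* (h (# 0) (# 2)) (minor (# 1) (# 2) (# 0) (# 1)))
    where
    minor : ∀ i i′ j j′ → IsInteger (m i j ℚ.* m i′ j′ ℚ.- m i j′ ℚ.* m i′ j)
    minor i i′ j j′ = integer-- (integer-* (h i j) (h i′ j′)) (integer-* (h i j′) (h i′ j))

  Tr-lin-* : ∀ α y → Tr (lin α ω * y) ≡ Σ₃ λ k → ℤ→ℚ (α k) ℚ.* Tr (ω k * y)
  Tr-lin-* α y = begin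
    Tr (lin α ω * y)
      ≡⟨ cong (λ x → Tr (x * y)) (lin≡ α ω) ⟩
    Tr ((embedℤ (α (# 0)) * ω (# 0) + embedℤ (α (# 1)) * ω (# 1) + embedℤ (α (# 2)) * ω (# 2)) * y)
      ≡⟨ cong Tr (solve 7 (λ a₀ a₁ a₂ w₀ w₁ w₂ y → (a₀ :* w₀ :+ a₁ :* w₁ :+ a₂ :* w₂) :* y
                             := a₀ :* (w₀ :* y) :+ a₁ :* (w₁ :* y) :+ a₂ :* (w₂ :* y))
                       refl (embedℤ (α (# 0))) (embedℤ (α (# 1))) (embedℤ (α (# 2))) (ω (# 0)) (ω (# 1)) (ω (# 2)) y) ⟩
    Tr (embedℤ (α (# 0)) * (ω (# 0) * y) + embedℤ (α (# 1)) * (ω (# 1) * y) + embedℤ (α (# 2)) * (ω (# 2) * y))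
      ≡⟨ trans (Tr-+ _ _) (cong₂ ℚ._+_ (Tr-+ _ _) refl) ⟩
    Tr (embedℤ (α (# 0)) * (ω (# 0) * y)) ℚ.+ Tr (embedℤ (α (# 1)) * (ω (# 1) * y)) ℚ.+ Tr (embedℤ (α (# 2)) * (ω (# 2) * y))
      ≡⟨ Σ₃-cong (λ k → Tr-embed-* (ℤ→ℚ (α k)) (ω k * y)) ⟩
    (Σ₃ λ k → ℤ→ℚ (α k) ℚ.* Tr (ω k * y)) ∎

  gram-lin : ∀ (A : Fin 3 → Fin 3 → ℤ) i j →
             Tr (lin (A i) ω *F lin (A j) ω) ≡ congruence (λ i k → ℤ→ℚ (A i k)) (λ k l → Tr (ω k *F ω l)) i j
  gram-lin A i j = begin
    Tr (lin (A i) ω *F lin (A j) ω)                  ≡⟨ cong Tr (*≡*F _ _) ⟨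
    Tr (lin (A i) ω * lin (A j) ω)                   ≡⟨ Tr-lin-* (A i) (lin (A j) ω) ⟩
    (Σ₃ λ k → ℤ→ℚ (A i k) ℚ.* Tr (ω k * lin (A j) ω)) ≡⟨ Σ₃-cong (λ k → cong (ℤ→ℚ (A i k) ℚ.*_) (inner k)) ⟩
    congruence (λ i k → ℤ→ℚ (A i k)) (λ k l → Tr (ω k *F ω l)) i j ∎
    where
    inner : ∀ k → Tr (ω k * lin (A j) ω) ≡ Σ₃ λ l → ℤ→ℚ (A j l) ℚ.* Tr (ω k *F ω l)
    inner k = trans (cong Tr (*-comm (ω k) (lin (A j) ω)))
                (trans (Tr-lin-* (A j) (ω k))
                  (Σ₃-cong λ l → cong (ℤ→ℚ (A j l) ℚ.*_) (cong Tr (trans (*-comm (ω l) (ω k)) (*≡*F (ω k) (ω l))))))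

  gram-det-integral : IsIntegralBasis ω → ∀ (v : Fin 3 → Elt) → (∀ i → IsIntegral (v i)) →
                      ∃ λ D → IsInteger D × det3 (λ i j → Tr (v i *F v j)) ≡ D ℚ.* D ℚ.* disc ω
  gram-det-integral (_ , spans) v v-integral =
    det3 Aℚ , det3-integer {Aℚ} (λ i j → A i j , refl) , (begin
      det3 (λ i j → Tr (v i *F v j))
        ≡⟨ det3-cong {λ i j → Tr (v i *F v j)} {λ i j → Tr (lin (A i) ω *F lin (A j) ω)}
                     (λ i j → cong₂ (λ x y → Tr (x *F y)) (v≡ i) (v≡ j)) ⟩
      det3 (λ i j → Tr (lin (A i) ω *F lin (A j) ω))
        ≡⟨ det3-cong {λ i j → Tr (lin (A i) ω *F lin (A j) ω)} {congruence Aℚ G} (gram-lin A) ⟩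
      det3 (congruence Aℚ G)
        ≡⟨ det3-congruence Aℚ G ⟩
      det3 Aℚ ℚ.* det3 Aℚ ℚ.* disc ω ∎)
    where
    A : Fin 3 → Fin 3 → ℤ
    A i = proj₁ (spans (v i) (v-integral i))
    v≡ : ∀ i → v i ≡ lin (A i) ω
    v≡ i = proj₂ (spans (v i) (v-integral i))
    Aℚ G : Fin 3 → Fin 3 → ℚ
    Aℚ i j = ℤ→ℚ (A i j)
    G k l = Tr (ω k *F ω l)

open import Data.Nat using (_^_; _*_)
open import Data.Integer using (+_)
open import Data.Rational using (_/_; _≤_)

proposition2p5 : (f : Cubic) → (σ : Elt → Elt) → (p : ℕ) →
    Arith.IsField f → Arith.IsCyclicGenerator f σ →
    Arith.HasDiscriminant f (ℤ→ℚ (+ (p ^ 2))) →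
    (g : Elt) → Arith.IsIntegral f g → (∀ (n : ℤ) → g ≢ Arith.embedℤ f n) →
    ∃ λ (q : ℚ) → Arith.normSq f σ g ≡ Arith.embed f q × (+ (2 * p)) / 3 ≤ q
proposition2p5 f σ p isField isCyclic (ω , basis , disc≡p²) g g-integral g∉ℤ =
  M , trans (normSq≡ σ g) sum-g² , bound (gram-det-integral basis family (family-integral g-integral))
  where
  open Arith f using (Tr; det3; disc; _*F_)
  open CubicField f using (normSq≡)
  open ElementConjugates f σ isField isCyclic g
  open Lattice f ω using (gram-det-integral)
  bound : (∃ λ D → IsInteger D × det3 (λ i j → Tr (family i *F family j)) ≡ D ℚ.* D ℚ.* disc ω) → + (2 * p) / 3 ≤ M
  bound (D , D-integer , gram≡) =
    norm-bound p {t} {M} {P} {D} t*t≡M+2P (0<M-P (non-integer⇒σg≢g g-integral g∉ℤ)) D-integer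
      (trans (sym det-gram-family) (trans gram≡ (cong (D ℚ.* D ℚ.*_) disc≡p²)))
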